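{- Let $r\ge 4$ and $t\ge 1$ be integers, let $n=t+1$ and $q=(r-2)t+1$, and let $H=H(n,r,q\mid\sigma)$ with $\sigma=(r-1,1)$. Then: (1) $H$ is $(2,2)$-colourable; (2) $\chi(H)=t+1\ge\sqrt{\frac{|V(H)|}{r-2}}$; (3) $H$ has no $(r+1)$-clique, i.e. $\omega(H)\le r$; (4) the number of edges of $H$ is $t(t+1)((r-2)t+1)\binom{(r-2)t+1}{r-1}$, which is $O(r\,t^{r+2}e^{r-1})$.
   Context: For positive integers $n,r,q$ and a partition $\sigma$ of $r$ (multiset of positive integers summing to $r$), the $\sigma$-hypergraph $H(n,r,q\mid\sigma)$ is the $r$-uniform hypergraph whose vertex set has $nq$ vertices partitioned into $n$ classes $V_1,\dots,V_n$ of $q$ vertices each, in which an $r$-subset $K$ of vertices is an edge if and only if the multiset of non-zero values among $|K\cap V_1|,\dots,|K\cap V_n|$ equals $\sigma$. A $(2,2)$-colouring is a vertex colouring in which every edge contains vertices of exactly two distinct colours. $\chi(H)$ is the minimum number of colours in a vertex colouring with no monochromatic edge. A clique is a set $S$ of vertices such that every $r$-subset of $S$ is an edge; $\omega(H)$ is the maximum size of a clique. -}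

module Defs where

open import Data.Nat using (ℕ; zero; suc; _+_; _*_; _∸_; _^_; _≤_; _≟_)
open import Data.Fin as Fin using (Fin; quotient)
open import Data.Fin.Subset using (Subset; _∈_; _⊆_; _∩_; ∣_∣; inside; outside)
open import Data.Vec using (tabulate)
open import Data.List using (List; _∷_; []; map; filter)
open import Data.List.Relation.Binary.Permutation.Propositional using (_↭_)
open import Data.Product using (Σ; _×_; ∃; ∃-syntax)
open import Relation.Nullary using (¬_; ¬?; yes; no)
open import Relation.Binary.PropositionalEquality using (_≡_; _≢_)
open import Data.List.Base using () renaming (tabulate to ltabulate)

-- Vertices of H(n,r,q|σ) are Fin (n * q); vertex v lies in class V_i
-- with i = quotient q v  (so each class has exactly q vertices).

classSet : (n q : ℕ) → Fin n → Subset (n * q)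
classSet n q i = tabulate λ v → decide (quotient q v Fin.≟ i)
  where
  decide : ∀ {P : Set} → Relation.Nullary.Dec P → _
  decide (yes _) = inside
  decide (no _)  = outside

intersectionSizes : (n q : ℕ) → Subset (n * q) → List ℕ
intersectionSizes n q K = ltabulate λ i → ∣ K ∩ classSet n q i ∣

nonZeroSizes : (n q : ℕ) → Subset (n * q) → List ℕ
nonZeroSizes n q K = filter (λ x → ¬? (x ≟ 0)) (intersectionSizes n q K)

-- Edges of the σ-hypergraph H(n,r,q|σ): r-subsets K whose multiset of
-- non-zero class intersection sizes equals σ.
IsEdge : (n r q : ℕ) (σ : List ℕ) → Subset (n * q) → Set
IsEdge n r q σ K = (∣ K ∣ ≡ r) × (nonZeroSizes n q K ↭ σ)

ProperColouring : (n r q : ℕ) (σ : List ℕ) (k : ℕ) → (Fin (n * q) → Fin k) → Set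
ProperColouring n r q σ k c =
  (K : Subset (n * q)) → IsEdge n r q σ K →
  ∃[ u ] ∃[ v ] (u ∈ K × v ∈ K × c u ≢ c v)

Is22Colouring : (n r q : ℕ) (σ : List ℕ) (k : ℕ) → (Fin (n * q) → Fin k) → Set
Is22Colouring n r q σ k c =
  (K : Subset (n * q)) → IsEdge n r q σ K →
  ∃[ a ] ∃[ b ] (a ≢ b
    × (∃[ u ] (u ∈ K × c u ≡ a))
    × (∃[ v ] (v ∈ K × c v ≡ b))
    × ((w : Fin (n * q)) → w ∈ K → (c w ≡ a Data.Sum.⊎ c w ≡ b)))
  where import Data.Sum

TwoTwoColourable : (n r q : ℕ) (σ : List ℕ) → Set
TwoTwoColourable n r q σ = ∃[ k ] ∃[ c ] Is22Colouring n r q σ k c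

ChromaticNumberIs : (n r q : ℕ) (σ : List ℕ) → ℕ → Set
ChromaticNumberIs n r q σ m =
  (∃[ c ] ProperColouring n r q σ m c) ×
  ((k : ℕ) (c : Fin (n * q) → Fin k) → ProperColouring n r q σ k c → m ≤ k)

IsClique : (n r q : ℕ) (σ : List ℕ) → Subset (n * q) → Set
IsClique n r q σ S =
  (K : Subset (n * q)) → K ⊆ S → ∣ K ∣ ≡ r → IsEdge n r q σ K

CliqueNumberAtMost : (n r q : ℕ) (σ : List ℕ) → ℕ → Set
CliqueNumberAtMost n r q σ m = (S : Subset (n * q)) → IsClique n r q σ S → ∣ S ∣ ≤ m

-- The edge set of H, as subsets K together with an (irrelevant) proof that
-- K is an edge; so its elements correspond exactly to the edges.
open import Data.Refinement using (Refinement)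
open import Function.Bundles using (_↔_)

EdgeSet : (n r q : ℕ) (σ : List ℕ) → Set
EdgeSet n r q σ = Refinement (Subset (n * q)) (IsEdge n r q σ)

NumberOfEdgesIs : (n r q : ℕ) (σ : List ℕ) → ℕ → Set
NumberOfEdgesIs n r q σ m = Fin m ↔ EdgeSet n r q σ

-- Write s = r ∸ 1, so that edges have class sizes (s, 1). Colouring every vertex by its
-- class gives each edge exactly two colours. With k ≤ t colours, each class of
-- q = (s ∸ 1) t + 1 vertices has a colour on at least s of its vertices, two of the t + 1
-- classes share such a colour, and s vertices of it in one class with one in the other form a
-- monochromatic edge. In a clique with s + 2 vertices every vertex could be removed leaving
-- class sizes (s, 1), which forces some class size outside {0, 1, s} once s ≥ 3. An edge is
-- determined by its major class, its minor class, the vertex in the minor class and the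
-- s-subset of the major class, which gives t (t + 1) q (q C s) edges.

module Submission where

open import Defs
open import Data.Nat using (ℕ; _+_; _*_; _∸_; _^_; _≤_; _!)
open import Data.Nat.Combinatorics using (_C_)
open import Data.List using (List; _∷_; [])
open import Data.List as List using (filter)
open import Data.List.Properties using (filter-accept; filter-reject)
open import Data.List.Membership.Propositional using () renaming (_∈_ to _∈ˡ_)
open import Data.List.Membership.Propositional.Properties using (∈-filter⁻; ∈-tabulate⁻)
open import Data.List.Relation.Binary.Permutation.Propositional using (_↭_; ↭-refl; ↭-sym; ↭-swap)
open import Data.List.Relation.Binary.Permutation.Propositional.Properties using (∈-resp-↭)
open import Data.List.Relation.Unary.Any using (here; there)
open import Data.Product using (_×_; ∃-syntax)

open import Data.Nat as ℕ using (zero; suc; _<_; z≤n; s≤s; _≤?_; _<?_; _≤ᵇ_)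
open import Data.Nat.Properties
open import Data.Bool using (Bool; true; false; _∧_)
import Data.Bool as Bool
open import Data.Bool.Properties using (∧-zeroʳ; ∧-identityʳ)
open import Data.Fin as Fin using (Fin; zero; suc; combine; quotient; remainder; punchIn; punchOut; _↑ˡ_; _↑ʳ_)
open import Data.Fin.Properties as FinP
  using (any?; punchInᵢ≢i; punchIn-punchOut; punchOut-injective; remQuot-combine; combine-remQuot)
open import Data.Fin.Subset using (Subset; inside; outside; _∩_; ∣_∣; _∈_; _⊆_; _-_; ⊥; ⁅_⁆; Nonempty)
open import Data.Fin.Subset.Properties
  using ( ∉⊥; ⊥⊆; ∣⁅x⁆∣≡1; in⊆in; out⊆; ⊆-antisym; ∣⊥∣≡0; x∈⁅x⁆; x∈⁅y⁆⇒x≡y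
        ; x∈p⇒∣p-x∣<∣p∣; x∈p∧x≢y⇒x∈p-y; Empty-unique)
open import Data.Vec using ([]; _∷_; lookup; tabulate)
open import Data.Vec.Properties
  using (≡-dec; lookup∘tabulate; lookup-zipWith; tabulate-cong; tabulate∘lookup; []=⇒lookup; lookup⇒[]=)
open import Data.Product using (_,_; proj₁; proj₂; ∃)
open import Data.Sum using (_⊎_; inj₁; inj₂)
import Data.Empty as Empty
open import Data.Vec.Functional using (updateAt)
open import Data.Vec.Functional.Properties using (updateAt-updates; updateAt-minimal)
open import Function using (_∘_; _∋_)
open import Function.Bundles using (_↔_; mk↔ₛ′)
open import Function.Properties.Inverse using (↔-refl; ↔-sym; ↔-trans)
open import Data.Sum.Function.Propositional using (_⊎-↔_)
open import Data.Product.Function.NonDependent.Propositional using (_×-↔_)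
open import Data.Refinement using (Refinement; _,_; value-injective)
open import Data.Irrelevant using ([_])
open import Data.Nat.Combinatorics using (nCk+nC[k+1]≡[n+1]C[k+1]; nCk≡nPk/k!; k>n⇒nCk≡0)
open import Data.Nat.Combinatorics.Base using (_P_; _P′_)
open import Data.Nat.DivMod using (_/_; m/n*n≤m)
open import Data.Nat.Tactic.RingSolver using (solve-∀)
open import Relation.Nullary using (¬_; ¬?; Dec; yes; no; does; contradiction)
open import Relation.Nullary.Decidable using (dec-true; dec-false; recompute)
open import Relation.Binary.PropositionalEquality

open import Algebra.Properties.CommutativeMonoid.Sum +-0-commutativeMonoid
  using (sum; sum-syntax; sum-cong-≗; sum-remove; ∑-comm)

sum-++ : ∀ m {k} (g : Fin (m + k) → ℕ) → sum g ≡ sum (g ∘ (_↑ˡ k)) + sum (g ∘ (m ↑ʳ_))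
sum-++ zero    g = refl
sum-++ (suc m) g = trans (cong (g zero +_) (sum-++ m (g ∘ suc))) (sym (+-assoc (g zero) _ _))

sum-combine : ∀ n q (g : Fin (n * q) → ℕ) → sum g ≡ ∑[ ℓ < n ] ∑[ a < q ] g (combine ℓ a)
sum-combine zero    q g = refl
sum-combine (suc n) q g = trans (sum-++ q g) (cong (sum (g ∘ (_↑ˡ n * q)) +_) (sum-combine n q (g ∘ (q ↑ʳ_))))

sum-const : ∀ n c → ∑[ i < n ] c ≡ n * c
sum-const zero    c = refl
sum-const (suc n) c = cong (c +_) (sum-const n c)

sum-zero : ∀ {n} (g : Fin n → ℕ) → (∀ i → g i ≡ 0) → sum g ≡ 0
sum-zero {zero}  g g≡0 = refl
sum-zero {suc n} g g≡0 = cong₂ _+_ (g≡0 zero) (sum-zero (g ∘ suc) (g≡0 ∘ suc))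

sum-mono-≤ : ∀ {n} {g h : Fin n → ℕ} → (∀ i → g i ≤ h i) → sum g ≤ sum h
sum-mono-≤ {zero}  g≤h = z≤n
sum-mono-≤ {suc n} g≤h = +-mono-≤ (g≤h zero) (sum-mono-≤ (g≤h ∘ suc))

sum-singleton : ∀ {n} (g : Fin n → ℕ) i → (∀ ℓ → ℓ ≢ i → g ℓ ≡ 0) → sum g ≡ g i
sum-singleton {suc n} g i g≡0 = begin
  sum g                     ≡⟨ sum-remove g ⟩
  g i + sum (g ∘ punchIn i) ≡⟨ cong (g i +_) (sum-zero _ (λ k → g≡0 _ (punchInᵢ≢i i k))) ⟩
  g i + 0                   ≡⟨ +-identityʳ (g i) ⟩
  g i                       ∎
  where open ≡-Reasoning

sum-pair : ∀ {n} (g : Fin n → ℕ) {i j} → i ≢ j → (∀ ℓ → ℓ ≢ i → ℓ ≢ j → g ℓ ≡ 0) → sum g ≡ g i + g j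
sum-pair {suc n} g {i} {j} i≢j g≡0 = begin
  sum g                                         ≡⟨ sum-remove g ⟩
  g i + sum (g ∘ punchIn i)                     ≡⟨ cong (g i +_) (sum-singleton (g ∘ punchIn i) (punchOut i≢j) rest) ⟩
  g i + g (punchIn i (punchOut i≢j))            ≡⟨ cong (λ ℓ → g i + g ℓ) (punchIn-punchOut i≢j) ⟩
  g i + g j                                     ∎
  where
  open ≡-Reasoning
  rest : ∀ k → k ≢ punchOut i≢j → g (punchIn i k) ≡ 0
  rest k k≢ = g≡0 _ (punchInᵢ≢i i k)
    (λ eq → k≢ (FinP.punchIn-injective i k _ (trans eq (sym (punchIn-punchOut i≢j)))))

≤-sum : ∀ {n} (g : Fin n → ℕ) i → g i ≤ sum g
≤-sum {suc n} g i = subst (g i ≤_) (sym (sum-remove g)) (m≤m+n (g i) _)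

pair≤sum : ∀ {n} (g : Fin n → ℕ) {i j} → i ≢ j → g i + g j ≤ sum g
pair≤sum {suc n} g {i} {j} i≢j = subst₂ (λ x y → g i + g x ≤ y) (punchIn-punchOut i≢j) (sym (sum-remove g))
  (+-monoʳ-≤ (g i) (≤-sum (g ∘ punchIn i) (punchOut i≢j)))

triple≤sum : ∀ {n} (g : Fin n → ℕ) {i j k} → i ≢ j → i ≢ k → j ≢ k → g i + g j + g k ≤ sum g
triple≤sum {suc n} g {i} {j} {k} i≢j i≢k j≢k =
  subst₂ (λ x y → x ≤ y) (sym (+-assoc (g i) (g j) (g k))) (sym (sum-remove g))
    (+-monoʳ-≤ (g i) (subst₂ (λ x y → g x + g y ≤ sum (g ∘ punchIn i)) (punchIn-punchOut i≢j) (punchIn-punchOut i≢k)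
      (pair≤sum (g ∘ punchIn i) (j≢k ∘ punchOut-injective i≢j i≢k))))

sum-pigeonhole : ∀ {k} (g : Fin k → ℕ) m → k * m < sum g → ∃ λ i → m < g i
sum-pigeonhole {k} g m km<∑g with any? (λ i → m <? g i)
... | yes found = found
... | no  none  = contradiction km<∑g (≤⇒≯ (begin
  sum g              ≤⟨ sum-mono-≤ (λ i → ≮⇒≥ (λ m<gi → none (i , m<gi))) ⟩
  ∑[ i < k ] m       ≡⟨ sum-const k m ⟩
  k * m              ∎))
  where open ≤-Reasoning

indicator : Bool → ℕ
indicator true  = 1
indicator false = 0

∣p∣≡∑ : ∀ {N} (p : Subset N) → ∣ p ∣ ≡ ∑[ a < N ] indicator (lookup p a)
∣p∣≡∑ []            = refl
∣p∣≡∑ (inside  ∷ p) = cong suc (∣p∣≡∑ p)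
∣p∣≡∑ (outside ∷ p) = ∣p∣≡∑ p

∣tabulate∣≡∑ : ∀ {N} (f : Fin N → Bool) → ∣ tabulate f ∣ ≡ ∑[ a < N ] indicator (f a)
∣tabulate∣≡∑ f = trans (∣p∣≡∑ (tabulate f)) (sum-cong-≗ (cong indicator ∘ lookup∘tabulate f))

x∈p⇒0<∣p∣ : ∀ {N} {x : Fin N} {p : Subset N} → x ∈ p → 0 < ∣ p ∣
x∈p⇒0<∣p∣ x∈p = ≤-<-trans z≤n (x∈p⇒∣p-x∣<∣p∣ x∈p)

0<∣p∣⇒Nonempty : ∀ {N} (p : Subset N) → 0 < ∣ p ∣ → Nonempty p
0<∣p∣⇒Nonempty (inside  ∷ p) _ = zero , Data.Vec.here
0<∣p∣⇒Nonempty (outside ∷ p) 0<∣p∣ with x , x∈p ← 0<∣p∣⇒Nonempty p 0<∣p∣ = suc x , Data.Vec.there x∈p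

∣p∣≡0⇒p≡⊥ : ∀ {N} {p : Subset N} → ∣ p ∣ ≡ 0 → p ≡ ⊥
∣p∣≡0⇒p≡⊥ ∣p∣≡0 = Empty-unique (λ (_ , x∈p) → <⇒≢ (x∈p⇒0<∣p∣ x∈p) (sym ∣p∣≡0))

-- Any second element x would leave y in p - x, making ∣ p - x ∣ positive yet smaller than 1.
y∈p∧∣p∣≡1⇒p≡⁅y⁆ : ∀ {N} {y : Fin N} {p : Subset N} → y ∈ p → ∣ p ∣ ≡ 1 → p ≡ ⁅ y ⁆
y∈p∧∣p∣≡1⇒p≡⁅y⁆ {y = y} {p} y∈p ∣p∣≡1 = ⊆-antisym p⊆⁅y⁆ ⁅y⁆⊆p
  where
  p⊆⁅y⁆ : p ⊆ ⁅ y ⁆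
  p⊆⁅y⁆ {x} x∈p with x Fin.≟ y
  ... | yes refl = x∈⁅x⁆ x
  ... | no  x≢y  = contradiction (n<1⇒n≡0 (subst (∣ p - x ∣ <_) ∣p∣≡1 (x∈p⇒∣p-x∣<∣p∣ x∈p)))
                     (>⇒≢ (x∈p⇒0<∣p∣ (x∈p∧x≢y⇒x∈p-y y∈p (x≢y ∘ sym))))
  ⁅y⁆⊆p : ⁅ y ⁆ ⊆ p
  ⁅y⁆⊆p x∈⁅y⁆ = subst (_∈ p) (sym (x∈⁅y⁆⇒x≡y y x∈⁅y⁆)) y∈p

subsetOfSize : ∀ {N} (p : Subset N) k → k ≤ ∣ p ∣ → ∃[ r ] r ⊆ p × ∣ r ∣ ≡ k
subsetOfSize {N} p zero _ = ⊥ , ⊥⊆ , ∣⊥∣≡0 N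
subsetOfSize (inside ∷ p) (suc k) (s≤s k≤∣p∣) with r , r⊆p , ∣r∣≡k ← subsetOfSize p k k≤∣p∣ =
  inside ∷ r , in⊆in r⊆p , cong suc ∣r∣≡k
subsetOfSize (outside ∷ p) (suc k) k<∣p∣ with r , r⊆p , ∣r∣≡k ← subsetOfSize p (suc k) k<∣p∣ =
  outside ∷ r , out⊆ r⊆p , ∣r∣≡k

does⇒ : ∀ {P : Set} (d : Dec P) → does d ≡ true → P
does⇒ (yes p) _ = p

∈⇒lookup : ∀ {N} {x : Fin N} {p : Subset N} → x ∈ p → lookup p x ≡ true
∈⇒lookup = []=⇒lookup

lookup⇒∈ : ∀ {N} {x : Fin N} {p : Subset N} → lookup p x ≡ true → x ∈ p
lookup⇒∈ {x = x} {p} = lookup⇒[]= x p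

module _ (n q : ℕ) where

  block : Subset (n * q) → Fin n → Subset q
  block K ℓ = tabulate (λ a → lookup K (combine ℓ a))

  fromBlocks : (Fin n → Subset q) → Subset (n * q)
  fromBlocks B = tabulate (λ v → lookup (B (quotient q v)) (remainder {n} q v))

  classSize : Subset (n * q) → Fin n → ℕ
  classSize K ℓ = ∣ K ∩ classSet n q ℓ ∣

module ClassBlocks {n q : ℕ} where

  quotient-combine : ∀ (ℓ : Fin n) (a : Fin q) → quotient {n} q (combine ℓ a) ≡ ℓ
  quotient-combine ℓ a = cong proj₁ (remQuot-combine ℓ a)

  remainder-combine : ∀ (ℓ : Fin n) (a : Fin q) → remainder {n} q (combine ℓ a) ≡ a
  remainder-combine ℓ a = cong proj₂ (remQuot-combine ℓ a)

  combine-quotient-remainder : ∀ (v : Fin (n * q)) → combine (quotient {n} q v) (remainder {n} q v) ≡ v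
  combine-quotient-remainder = combine-remQuot {n} q

  -- The decision function inside classSet is local to a where block and cannot be named;
  -- the ascription unfolds the lookup to it, so that abstracting the decision evaluates it.
  lookup-classSet : ∀ ℓ v → lookup (classSet n q ℓ) v ≡ does (quotient {n} q v Fin.≟ ℓ)
  lookup-classSet ℓ v with quotient {n} q v Fin.≟ ℓ | (lookup (classSet n q ℓ) v ≡ _) ∋ lookup∘tabulate _ v
  ... | yes _ | eq = eq
  ... | no  _ | eq = eq

  lookup-block : ∀ K ℓ a → lookup (block n q K ℓ) a ≡ lookup K (combine ℓ a)
  lookup-block K ℓ a = lookup∘tabulate _ a

  lookup-fromBlocks : ∀ B ℓ a → lookup (fromBlocks n q B) (combine ℓ a) ≡ lookup (B ℓ) a
  lookup-fromBlocks B ℓ a =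
    trans (lookup∘tabulate _ (combine ℓ a))
          (cong₂ (λ ℓ′ a′ → lookup (B ℓ′) a′) (quotient-combine ℓ a) (remainder-combine ℓ a))

  block-fromBlocks : ∀ B ℓ → block n q (fromBlocks n q B) ℓ ≡ B ℓ
  block-fromBlocks B ℓ = trans (tabulate-cong (lookup-fromBlocks B ℓ)) (tabulate∘lookup (B ℓ))

  fromBlocks-block : ∀ K → fromBlocks n q (block n q K) ≡ K
  fromBlocks-block K = trans (tabulate-cong (λ v → trans (lookup-block K _ _) (cong (lookup K) (combine-quotient-remainder v))))
                             (tabulate∘lookup K)

  ∈-block⁻ : ∀ {K ℓ a} → a ∈ block n q K ℓ → combine ℓ a ∈ K
  ∈-block⁻ {K} {ℓ} {a} a∈ = lookup⇒∈ (trans (sym (lookup-block K ℓ a)) (∈⇒lookup a∈))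

  ∈-block⁺ : ∀ {K v} → v ∈ K → remainder {n} q v ∈ block n q K (quotient {n} q v)
  ∈-block⁺ {K} {v} v∈K =
    lookup⇒∈ (trans (lookup-block K _ _) (trans (cong (lookup K) (combine-quotient-remainder v)) (∈⇒lookup v∈K)))

  ∈-fromBlocks⁻ : ∀ {B v} → v ∈ fromBlocks n q B → remainder {n} q v ∈ B (quotient {n} q v)
  ∈-fromBlocks⁻ {B} {v} v∈ = lookup⇒∈ (trans (sym (lookup∘tabulate _ v)) (∈⇒lookup v∈))

  fromBlocks-mono : ∀ {B B′} → (∀ ℓ → B ℓ ⊆ B′ ℓ) → fromBlocks n q B ⊆ fromBlocks n q B′
  fromBlocks-mono {B} {B′} B⊆B′ {v} v∈ =
    lookup⇒∈ (trans (lookup∘tabulate _ v) (∈⇒lookup (B⊆B′ (quotient {n} q v) (∈-fromBlocks⁻ {B} v∈))))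

  lookup-∩-classSet : ∀ K ℓ ℓ′ a →
    lookup (K ∩ classSet n q ℓ) (combine ℓ′ a) ≡ lookup K (combine ℓ′ a) ∧ does (ℓ′ Fin.≟ ℓ)
  lookup-∩-classSet K ℓ ℓ′ a = trans (lookup-zipWith _∧_ (combine ℓ′ a) K (classSet n q ℓ))
    (cong (lookup K (combine ℓ′ a) ∧_)
      (trans (lookup-classSet ℓ (combine ℓ′ a)) (cong (λ x → does (x Fin.≟ ℓ)) (quotient-combine ℓ′ a))))

  classSize≡∣block∣ : ∀ K ℓ → classSize n q K ℓ ≡ ∣ block n q K ℓ ∣
  classSize≡∣block∣ K ℓ = begin
    ∣ K ∩ classSet n q ℓ ∣
      ≡⟨ trans (∣p∣≡∑ (K ∩ classSet n q ℓ)) (sum-combine n q _) ⟩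
    ∑[ ℓ′ < n ] ∑[ a < q ] indicator (inClass ℓ′ a)
      ≡⟨ sum-singleton (λ ℓ′ → ∑[ a < q ] indicator (inClass ℓ′ a)) ℓ
           (λ ℓ′ ℓ′≢ℓ → sum-zero _ (cong indicator ∘ otherClass ℓ′ ℓ′≢ℓ)) ⟩
    ∑[ a < q ] indicator (inClass ℓ a)
      ≡⟨ sum-cong-≗ (cong indicator ∘ ownClass) ⟩
    ∑[ a < q ] indicator (lookup K (combine ℓ a))
      ≡⟨ ∣tabulate∣≡∑ {q} (λ a → lookup K (combine ℓ a)) ⟨
    ∣ block n q K ℓ ∣
      ∎
    where
    open ≡-Reasoning
    inClass : Fin n → Fin q → Bool
    inClass ℓ′ a = lookup (K ∩ classSet n q ℓ) (combine ℓ′ a)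
    otherClass : ∀ ℓ′ → ℓ′ ≢ ℓ → ∀ a → inClass ℓ′ a ≡ false
    otherClass ℓ′ ℓ′≢ℓ a = begin
      inClass ℓ′ a                                ≡⟨ lookup-∩-classSet K ℓ ℓ′ a ⟩
      lookup K (combine ℓ′ a) ∧ does (ℓ′ Fin.≟ ℓ) ≡⟨ cong (lookup K (combine ℓ′ a) ∧_) (dec-false (ℓ′ Fin.≟ ℓ) ℓ′≢ℓ) ⟩
      lookup K (combine ℓ′ a) ∧ false             ≡⟨ ∧-zeroʳ _ ⟩
      false                                       ∎
    ownClass : ∀ a → inClass ℓ a ≡ lookup K (combine ℓ a)
    ownClass a = begin
      inClass ℓ a                               ≡⟨ lookup-∩-classSet K ℓ ℓ a ⟩
      lookup K (combine ℓ a) ∧ does (ℓ Fin.≟ ℓ) ≡⟨ cong (lookup K (combine ℓ a) ∧_) (dec-true (ℓ Fin.≟ ℓ) refl) ⟩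
      lookup K (combine ℓ a) ∧ true             ≡⟨ ∧-identityʳ _ ⟩
      lookup K (combine ℓ a)                    ∎

  ∣K∣≡∑classSize : ∀ K → ∣ K ∣ ≡ ∑[ ℓ < n ] classSize n q K ℓ
  ∣K∣≡∑classSize K = begin
    ∣ K ∣
      ≡⟨ trans (∣p∣≡∑ K) (sum-combine n q _) ⟩
    ∑[ ℓ < n ] ∑[ a < q ] indicator (lookup K (combine ℓ a))
      ≡⟨ sum-cong-≗ {n} (λ ℓ → ∣tabulate∣≡∑ {q} (λ a → lookup K (combine ℓ a))) ⟨
    ∑[ ℓ < n ] ∣ block n q K ℓ ∣
      ≡⟨ sum-cong-≗ (classSize≡∣block∣ K) ⟨
    ∑[ ℓ < n ] classSize n q K ℓ
      ∎
    where open ≡-Reasoning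

  classSize-fromBlocks : ∀ B ℓ → classSize n q (fromBlocks n q B) ℓ ≡ ∣ B ℓ ∣
  classSize-fromBlocks B ℓ = trans (classSize≡∣block∣ (fromBlocks n q B) ℓ) (cong ∣_∣ (block-fromBlocks B ℓ))

  occupied : ∀ {K v} → v ∈ K → 0 < classSize n q K (quotient {n} q v)
  occupied {K} v∈K = subst (0 <_) (sym (classSize≡∣block∣ K _)) (x∈p⇒0<∣p∣ (∈-block⁺ {K} v∈K))

  inhabitant : ∀ {K} ℓ → 0 < classSize n q K ℓ → ∃ λ v → v ∈ K × quotient {n} q v ≡ ℓ
  inhabitant {K} ℓ 0<size
    with a , a∈ ← 0<∣p∣⇒Nonempty (block n q K ℓ) (subst (0 <_) (classSize≡∣block∣ K ℓ) 0<size) =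
    combine ℓ a , ∈-block⁻ {K} a∈ , quotient-combine ℓ a

-- Edges of H(n, s + 1, q | (s, 1))

record Profile {n} (s : ℕ) (g : Fin n → ℕ) : Set where
  field
    major minor : Fin n
    major≢minor : major ≢ minor
    at-major    : g major ≡ s
    at-minor    : g minor ≡ 1
    elsewhere   : ∀ ℓ → ℓ ≢ major → ℓ ≢ minor → g ℓ ≡ 0

module _ {n s} {g : Fin n → ℕ} (π : Profile s g) where
  open Profile π

  profile-values : ∀ ℓ → g ℓ ≡ 0 ⊎ g ℓ ≡ 1 ⊎ g ℓ ≡ s
  profile-values ℓ with ℓ Fin.≟ major | ℓ Fin.≟ minor
  ... | yes refl | _        = inj₂ (inj₂ at-major)
  ... | no _     | yes refl = inj₂ (inj₁ at-minor)
  ... | no ℓ≢M   | no ℓ≢m   = inj₁ (elsewhere ℓ ℓ≢M ℓ≢m)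

  profile-sum : sum g ≡ s + 1
  profile-sum = trans (sum-pair g major≢minor elsewhere) (cong₂ _+_ at-major at-minor)

  major-unique : 2 ≤ s → ∀ {ℓ} → g ℓ ≡ s → ℓ ≡ major
  major-unique 2≤s {ℓ} gℓ≡s with profile-values ℓ | ℓ Fin.≟ major
  ... | _                 | yes ℓ≡M = ℓ≡M
  ... | inj₁ gℓ≡0         | no _    = contradiction (trans (sym gℓ≡s) gℓ≡0) (>⇒≢ (≤-trans (s≤s z≤n) 2≤s))
  ... | inj₂ (inj₁ gℓ≡1)  | no _    = contradiction (trans (sym gℓ≡s) gℓ≡1) (>⇒≢ 2≤s)
  ... | inj₂ (inj₂ _)     | no ℓ≢M  with ℓ Fin.≟ minor
  ...   | yes refl = contradiction (trans (sym gℓ≡s) at-minor) (>⇒≢ 2≤s)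
  ...   | no ℓ≢m   = contradiction (trans (sym gℓ≡s) (elsewhere ℓ ℓ≢M ℓ≢m)) (>⇒≢ (≤-trans (s≤s z≤n) 2≤s))

  minor-unique : 2 ≤ s → ∀ {ℓ} → g ℓ ≡ 1 → ℓ ≡ minor
  minor-unique 2≤s {ℓ} gℓ≡1 with ℓ Fin.≟ minor | ℓ Fin.≟ major
  ... | yes ℓ≡m | _        = ℓ≡m
  ... | no _    | yes refl = contradiction (trans (sym at-major) gℓ≡1) (>⇒≢ 2≤s)
  ... | no ℓ≢m  | no ℓ≢M   = contradiction (trans (sym gℓ≡1) (elsewhere ℓ ℓ≢M ℓ≢m)) λ ()

Profile-resp : ∀ {n s} {g h : Fin n → ℕ} → (∀ ℓ → g ℓ ≡ h ℓ) → Profile s g → Profile s h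
Profile-resp g≗h π = record
  { major = major ; minor = minor ; major≢minor = major≢minor
  ; at-major = trans (sym (g≗h major)) at-major
  ; at-minor = trans (sym (g≗h minor)) at-minor
  ; elsewhere = λ ℓ ℓ≢M ℓ≢m → trans (sym (g≗h ℓ)) (elsewhere ℓ ℓ≢M ℓ≢m)
  }
  where open Profile π

nonZeros : List ℕ → List ℕ
nonZeros = filter (λ x → ¬? (x ℕ.≟ 0))

nonZeros-zero∷ : ∀ {x} xs → x ≡ 0 → nonZeros (x ∷ xs) ≡ nonZeros xs
nonZeros-zero∷ xs x≡0 = filter-reject (λ x → ¬? (x ℕ.≟ 0)) (λ x≢0 → x≢0 x≡0)

nonZeros-nonzero∷ : ∀ {x} xs → x ≢ 0 → nonZeros (x ∷ xs) ≡ x ∷ nonZeros xs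
nonZeros-nonzero∷ xs x≢0 = filter-accept (λ x → ¬? (x ℕ.≟ 0)) x≢0

nonZeros-none : ∀ {n} (g : Fin n → ℕ) → (∀ ℓ → g ℓ ≡ 0) → nonZeros (List.tabulate g) ≡ []
nonZeros-none {zero}  g g≡0 = refl
nonZeros-none {suc n} g g≡0 = trans (nonZeros-zero∷ _ (g≡0 zero)) (nonZeros-none (g ∘ suc) (g≡0 ∘ suc))

nonZeros-single : ∀ {n} (g : Fin n → ℕ) {i} → g i ≢ 0 → (∀ ℓ → ℓ ≢ i → g ℓ ≡ 0) →
                  nonZeros (List.tabulate g) ≡ g i ∷ []
nonZeros-single {suc n} g {zero} gi≢0 g≡0 =
  trans (nonZeros-nonzero∷ _ gi≢0) (cong (g zero ∷_) (nonZeros-none (g ∘ suc) (λ ℓ → g≡0 (suc ℓ) λ ())))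
nonZeros-single {suc n} g {suc i} gi≢0 g≡0 =
  trans (nonZeros-zero∷ _ (g≡0 zero λ ()))
        (nonZeros-single (g ∘ suc) gi≢0 (λ ℓ ℓ≢i → g≡0 (suc ℓ) (ℓ≢i ∘ FinP.suc-injective)))

nonZeros-pair : ∀ {n} (g : Fin n → ℕ) {i j} → i ≢ j → g i ≢ 0 → g j ≢ 0 →
                (∀ ℓ → ℓ ≢ i → ℓ ≢ j → g ℓ ≡ 0) →
                nonZeros (List.tabulate g) ↭ g i ∷ g j ∷ []
nonZeros-pair {suc n} g {zero}  {zero}  i≢j _ _ _ = contradiction refl i≢j
nonZeros-pair {suc n} g {zero}  {suc j} _ gi≢0 gj≢0 g≡0
  rewrite nonZeros-nonzero∷ (List.tabulate (g ∘ suc)) gi≢0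
        | nonZeros-single (g ∘ suc) gj≢0 (λ ℓ ℓ≢j → g≡0 (suc ℓ) (λ ()) (ℓ≢j ∘ FinP.suc-injective)) = ↭-refl
nonZeros-pair {suc n} g {suc i} {zero}  _ gi≢0 gj≢0 g≡0
  rewrite nonZeros-nonzero∷ (List.tabulate (g ∘ suc)) gj≢0
        | nonZeros-single (g ∘ suc) gi≢0 (λ ℓ ℓ≢i → g≡0 (suc ℓ) (ℓ≢i ∘ FinP.suc-injective) (λ ()))
        = ↭-swap _ _ ↭-refl
nonZeros-pair {suc n} g {suc i} {suc j} i≢j gi≢0 gj≢0 g≡0
  rewrite nonZeros-zero∷ (List.tabulate (g ∘ suc)) (g≡0 zero (λ ()) (λ ())) =
  nonZeros-pair (g ∘ suc) (i≢j ∘ cong suc) gi≢0 gj≢0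
    (λ ℓ ℓ≢i ℓ≢j → g≡0 (suc ℓ) (ℓ≢i ∘ FinP.suc-injective) (ℓ≢j ∘ FinP.suc-injective))

∈-nonZeros⁻ : ∀ {n} (g : Fin n → ℕ) {x} → x ∈ˡ nonZeros (List.tabulate g) → ∃ λ ℓ → g ℓ ≡ x
∈-nonZeros⁻ g x∈ with ℓ , x≡gℓ ← ∈-tabulate⁻ (proj₁ (∈-filter⁻ (λ x → ¬? (x ℕ.≟ 0)) x∈)) =
  ℓ , sym x≡gℓ

module _ {n q s : ℕ} where
  open ClassBlocks {n} {q}

  edge⇒profile : 2 ≤ s → ∀ {K} → IsEdge n (suc s) q (s ∷ 1 ∷ []) K → Profile s (classSize n q K)
  edge⇒profile 2≤s {K} (∣K∣≡1+s , sizes↭σ)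
    with i , gi≡s ← ∈-nonZeros⁻ (classSize n q K) (∈-resp-↭ (↭-sym sizes↭σ) (here refl))
       | j , gj≡1 ← ∈-nonZeros⁻ (classSize n q K) (∈-resp-↭ (↭-sym sizes↭σ) (there (here refl)))
    = record { major = i ; minor = j ; major≢minor = i≢j ; at-major = gi≡s ; at-minor = gj≡1 ; elsewhere = empty }
    where
    g : Fin n → ℕ
    g = classSize n q K
    i≢j : i ≢ j
    i≢j refl = contradiction (trans (sym gi≡s) gj≡1) (>⇒≢ 2≤s)
    empty : ∀ ℓ → ℓ ≢ i → ℓ ≢ j → g ℓ ≡ 0
    empty ℓ ℓ≢i ℓ≢j = n≤0⇒n≡0 (+-cancelˡ-≤ (s + 1) (g ℓ) 0 (begin
      s + 1 + g ℓ     ≡⟨ cong (λ x → x + g ℓ) (sym (cong₂ _+_ gi≡s gj≡1)) ⟩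
      g i + g j + g ℓ ≤⟨ triple≤sum g i≢j (ℓ≢i ∘ sym) (ℓ≢j ∘ sym) ⟩
      sum g           ≡⟨ sym (∣K∣≡∑classSize K) ⟩
      ∣ K ∣           ≡⟨ trans ∣K∣≡1+s (+-comm 1 s) ⟩
      s + 1           ≡⟨ sym (+-identityʳ (s + 1)) ⟩
      s + 1 + 0       ∎))
      where open ≤-Reasoning

  profile⇒edge : 1 ≤ s → ∀ {K} → Profile s (classSize n q K) → IsEdge n (suc s) q (s ∷ 1 ∷ []) K
  profile⇒edge 1≤s {K} π =
    trans (∣K∣≡∑classSize K) (trans (profile-sum π) (+-comm s 1)) ,
    subst₂ (λ x y → nonZeroSizes n q K ↭ x ∷ y ∷ []) at-major at-minor
      (nonZeros-pair (classSize n q K) major≢minor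
        (λ gM≡0 → >⇒≢ 1≤s (trans (sym at-major) gM≡0))
        (λ gm≡0 → contradiction (trans (sym at-minor) gm≡0) λ ())
        elsewhere)
    where open Profile π

module _ {n q : ℕ} where
  open ClassBlocks {n} {q}

  twoBlocks : Fin n → Fin n → Subset q → Fin q → Fin n → Subset q
  twoBlocks i j A y ℓ with ℓ Fin.≟ i | ℓ Fin.≟ j
  ... | yes _ | _     = A
  ... | no _  | yes _ = ⁅ y ⁆
  ... | no _  | no _  = ⊥

  twoClassSet : Fin n → Fin n → Subset q → Fin q → Subset (n * q)
  twoClassSet i j A y = fromBlocks n q (twoBlocks i j A y)

  module _ {i j : Fin n} (i≢j : i ≢ j) (A : Subset q) (y : Fin q) where

    twoBlocks-major : twoBlocks i j A y i ≡ A
    twoBlocks-major with i Fin.≟ i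
    ... | yes _  = refl
    ... | no i≢i = contradiction refl i≢i

    twoBlocks-minor : twoBlocks i j A y j ≡ ⁅ y ⁆
    twoBlocks-minor with j Fin.≟ i | j Fin.≟ j
    ... | yes j≡i | _       = contradiction (sym j≡i) i≢j
    ... | no _    | yes _   = refl
    ... | no _    | no j≢j  = contradiction refl j≢j

    twoBlocks-elsewhere : ∀ ℓ → ℓ ≢ i → ℓ ≢ j → twoBlocks i j A y ℓ ≡ ⊥
    twoBlocks-elsewhere ℓ ℓ≢i ℓ≢j with ℓ Fin.≟ i | ℓ Fin.≟ j
    ... | yes ℓ≡i | _       = contradiction ℓ≡i ℓ≢i
    ... | no _    | yes ℓ≡j = contradiction ℓ≡j ℓ≢j
    ... | no _    | no _    = refl

    twoClassSet-profile : ∀ {s} → ∣ A ∣ ≡ s → Profile s (classSize n q (twoClassSet i j A y))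
    twoClassSet-profile ∣A∣≡s = record
      { major = i ; minor = j ; major≢minor = i≢j
      ; at-major  = trans (classSize-fromBlocks (twoBlocks i j A y) i) (trans (cong ∣_∣ twoBlocks-major) ∣A∣≡s)
      ; at-minor  = trans (classSize-fromBlocks (twoBlocks i j A y) j) (trans (cong ∣_∣ twoBlocks-minor) (∣⁅x⁆∣≡1 y))
      ; elsewhere = λ ℓ ℓ≢i ℓ≢j → trans (classSize-fromBlocks (twoBlocks i j A y) ℓ)
                                    (trans (cong ∣_∣ (twoBlocks-elsewhere ℓ ℓ≢i ℓ≢j)) (∣⊥∣≡0 q))
      }

  ∈-twoClassSet⁻ : ∀ {i j A y v} → v ∈ twoClassSet i j A y →
                   (quotient {n} q v ≡ i × remainder {n} q v ∈ A) ⊎ (quotient {n} q v ≡ j × remainder {n} q v ≡ y)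
  ∈-twoClassSet⁻ {i} {j} {A} {y} {v} v∈ with ∈-fromBlocks⁻ {B = twoBlocks i j A y} v∈
  ... | a∈ with quotient {n} q v Fin.≟ i | quotient {n} q v Fin.≟ j
  ...   | yes ℓ≡i | _       = inj₁ (ℓ≡i , a∈)
  ...   | no _    | yes ℓ≡j = inj₂ (ℓ≡j , x∈⁅y⁆⇒x≡y y a∈)
  ...   | no _    | no _    = contradiction a∈ ∉⊥

  fromBlocks-cong : ∀ {B B′} → (∀ ℓ → B ℓ ≡ B′ ℓ) → fromBlocks n q B ≡ fromBlocks n q B′
  fromBlocks-cong B≗B′ = tabulate-cong (λ v → cong (λ X → lookup X (remainder {n} q v)) (B≗B′ (quotient {n} q v)))

  profile⇒twoClassSet : ∀ {s K} → 2 ≤ s → Profile s (classSize n q K) → ∀ {i j y} →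
    classSize n q K i ≡ s → classSize n q K j ≡ 1 → y ∈ block n q K j → K ≡ twoClassSet i j (block n q K i) y
  profile⇒twoClassSet {s} {K} 2≤s π {y = y} at-i at-j y∈ with major-unique π 2≤s at-i | minor-unique π 2≤s at-j
  ... | refl | refl = trans (sym (fromBlocks-block K)) (fromBlocks-cong blocks)
    where
    open Profile π
    blocks : ∀ ℓ → block n q K ℓ ≡ twoBlocks major minor (block n q K major) y ℓ
    blocks ℓ with ℓ Fin.≟ major | ℓ Fin.≟ minor
    ... | yes refl | _        = refl
    ... | no _     | yes refl = y∈p∧∣p∣≡1⇒p≡⁅y⁆ y∈ (trans (sym (classSize≡∣block∣ K ℓ)) at-minor)
    ... | no ℓ≢M   | no ℓ≢m   = ∣p∣≡0⇒p≡⊥ (trans (sym (classSize≡∣block∣ K ℓ)) (elsewhere ℓ ℓ≢M ℓ≢m))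

-- Colourings

Is22Colouring⇒ProperColouring : ∀ {n r q σ k c} → Is22Colouring n r q σ k c → ProperColouring n r q σ k c
Is22Colouring⇒ProperColouring 22c K e with _ , _ , a≢b , (u , u∈K , cu≡a) , (v , v∈K , cv≡b) , _ ← 22c K e =
  u , v , u∈K , v∈K , λ cu≡cv → a≢b (trans (sym cu≡a) (trans cu≡cv cv≡b))

module _ {n q s : ℕ} (2≤s : 2 ≤ s) where
  open ClassBlocks {n} {q}

  classColouring-22 : Is22Colouring n (suc s) q (s ∷ 1 ∷ []) n (quotient {n} q)
  classColouring-22 K e = major , minor , major≢minor ,
    inhabitant major (subst (0 <_) (sym at-major) (≤-trans (s≤s z≤n) 2≤s)) ,
    inhabitant minor (subst (0 <_) (sym at-minor) (s≤s z≤n)) ,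
    onlyTwo
    where
    open Profile (edge⇒profile {n} {q} 2≤s {K} e)
    onlyTwo : ∀ w → w ∈ K → quotient {n} q w ≡ major ⊎ quotient {n} q w ≡ minor
    onlyTwo w w∈K with quotient {n} q w Fin.≟ major | quotient {n} q w Fin.≟ minor
    ... | yes ℓ≡M | _       = inj₁ ℓ≡M
    ... | no _    | yes ℓ≡m = inj₂ ℓ≡m
    ... | no ℓ≢M  | no ℓ≢m  = contradiction (elsewhere _ ℓ≢M ℓ≢m) (>⇒≢ (occupied w∈K))

module _ {n q k : ℕ} (c : Fin (n * q) → Fin k) where
  open ClassBlocks {n} {q}

  colourClass : Fin n → Fin k → Subset q
  colourClass ℓ col = tabulate (λ a → does (c (combine ℓ a) Fin.≟ col))

  ∑∣colourClass∣ : ∀ ℓ → ∑[ col < k ] ∣ colourClass ℓ col ∣ ≡ q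
  ∑∣colourClass∣ ℓ = begin
    ∑[ col < k ] ∣ colourClass ℓ col ∣            ≡⟨ sum-cong-≗ (λ col → ∣tabulate∣≡∑ (hasColour col)) ⟩
    ∑[ col < k ] ∑[ a < q ] indicator (hasColour col a) ≡⟨ ∑-comm (λ col a → indicator (hasColour col a)) ⟩
    ∑[ a < q ] ∑[ col < k ] indicator (hasColour col a) ≡⟨ sum-cong-≗ oneColour ⟩
    ∑[ a < q ] 1                                  ≡⟨ trans (sum-const q 1) (*-identityʳ q) ⟩
    q                                             ∎
    where
    open ≡-Reasoning
    hasColour : Fin k → Fin q → Bool
    hasColour col a = does (c (combine ℓ a) Fin.≟ col)
    oneColour : ∀ a → ∑[ col < k ] indicator (hasColour col a) ≡ 1
    oneColour a = trans (sum-singleton (λ col → indicator (hasColour col a)) (c (combine ℓ a))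
                          (λ col col≢ → cong indicator (dec-false (c (combine ℓ a) Fin.≟ col) (col≢ ∘ sym))))
                        (cong indicator (dec-true (c (combine ℓ a) Fin.≟ c (combine ℓ a)) refl))

  inColourClass : ∀ {ℓ col a} → a ∈ colourClass ℓ col → c (combine ℓ a) ≡ col
  inColourClass {ℓ} {col} {a} a∈ = does⇒ (c (combine ℓ a) Fin.≟ col) (trans (sym (lookup∘tabulate _ a)) (∈⇒lookup a∈))

  module _ {m} (km<q : k * m < q) where

    majority-exists : ∀ ℓ → ∃ λ col → m < ∣ colourClass ℓ col ∣
    majority-exists ℓ = sum-pigeonhole _ m (subst (k * m <_) (sym (∑∣colourClass∣ ℓ)) km<q)

    majority : Fin n → Fin k
    majority ℓ = proj₁ (majority-exists ℓ)

    majority-large : ∀ ℓ → suc m ≤ ∣ colourClass ℓ (majority ℓ) ∣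
    majority-large ℓ = proj₂ (majority-exists ℓ)

    -- m + 1 vertices of the majority colour of class i and one of class j.
    monochromaticEdge : ∀ {i j} → i ≢ j → majority i ≡ majority j →
      ∃[ K ] IsEdge n (suc (suc m)) q (suc m ∷ 1 ∷ []) K × (∀ {w} → w ∈ K → c w ≡ majority i)
    monochromaticEdge {i} {j} i≢j same
      with A , A⊆ , ∣A∣≡1+m ← subsetOfSize (colourClass i (majority i)) (suc m) (majority-large i)
         | y , y∈ ← 0<∣p∣⇒Nonempty (colourClass j (majority j)) (≤-trans (s≤s z≤n) (majority-large j))
      = twoClassSet i j A y
      , profile⇒edge {n} {q} (s≤s z≤n) {twoClassSet i j A y} (twoClassSet-profile i≢j A y ∣A∣≡1+m)
      , coloured
      where
      coloured : ∀ {w} → w ∈ twoClassSet i j A y → c w ≡ majority i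
      coloured {w} w∈K with ∈-twoClassSet⁻ {i = i} {j} {A} {y} w∈K
      ... | inj₁ (refl , a∈A) = trans (cong c (sym (combine-quotient-remainder w))) (inColourClass (A⊆ a∈A))
      ... | inj₂ (refl , refl) = trans (cong c (sym (combine-quotient-remainder w))) (trans (inColourClass y∈) (sym same))

  properColouring⇒n≤k : ∀ {m} → ProperColouring n (suc (suc m)) q (suc m ∷ 1 ∷ []) k c → k * m < q → n ≤ k
  properColouring⇒n≤k proper km<q with n ≤? k
  ... | yes n≤k = n≤k
  ... | no  n≰k
    with i , j , i<j , same ← FinP.pigeonhole (≰⇒> n≰k) (majority km<q)
    with K , edge , coloured ← monochromaticEdge km<q (FinP.<⇒≢ i<j) same
    with u , v , u∈K , v∈K , cu≢cv ← proper K edge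
    = contradiction (trans (coloured u∈K) (sym (coloured v∈K))) cu≢cv

-- Cliques

decrement : ∀ {n} → (Fin n → ℕ) → Fin n → Fin n → ℕ
decrement g ℓ = updateAt g ℓ (_∸ 1)

decrement-≤ : ∀ {n} (g : Fin n → ℕ) ℓ ℓ′ → decrement g ℓ ℓ′ ≤ g ℓ′
decrement-≤ g ℓ ℓ′ with ℓ′ Fin.≟ ℓ
... | yes refl  = subst (_≤ g ℓ) (sym (updateAt-updates ℓ g)) (m∸n≤m (g ℓ) 1)
... | no  ℓ′≢ℓ  = ≤-reflexive (updateAt-minimal ℓ′ ℓ g ℓ′≢ℓ)

sum-decrement : ∀ {n} (g : Fin n → ℕ) ℓ → 0 < g ℓ → suc (sum (decrement g ℓ)) ≡ sum g
sum-decrement {suc n} g ℓ 0<gℓ = begin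
  suc (sum (decrement g ℓ))
    ≡⟨ cong suc (sum-remove (decrement g ℓ)) ⟩
  suc (decrement g ℓ ℓ + sum (decrement g ℓ ∘ punchIn ℓ))
    ≡⟨ cong₂ (λ x y → suc (x + y)) (updateAt-updates ℓ g)
             (sum-cong-≗ (λ k → updateAt-minimal (punchIn ℓ k) ℓ g (punchInᵢ≢i ℓ k))) ⟩
  suc (g ℓ ∸ 1 + sum (g ∘ punchIn ℓ))
    ≡⟨ cong (_+ sum (g ∘ punchIn ℓ)) (trans (+-comm 1 (g ℓ ∸ 1)) (m∸n+n≡m 0<gℓ)) ⟩
  g ℓ + sum (g ∘ punchIn ℓ)
    ≡⟨ sum-remove g ⟨
  sum g
    ∎
  where open ≡-Reasoning

notProfileValue : ∀ {s x} → 2 ≤ x → x ≢ s → ¬ (x ≡ 0 ⊎ x ≡ 1 ⊎ x ≡ s)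
notProfileValue (s≤s (s≤s _)) x≢s (inj₂ (inj₂ x≡s)) = x≢s x≡s

module Removal {n s} (g : Fin n → ℕ) {ℓ₀} (0<gℓ₀ : 0 < g ℓ₀) (π : Profile s (decrement g ℓ₀)) where
  open Profile π

  removedAtMajor⇒g-major : major ≡ ℓ₀ → g major ≡ suc s
  removedAtMajor⇒g-major refl =
    trans (sym (m∸n+n≡m 0<gℓ₀)) (trans (cong (_+ 1) (trans (sym (updateAt-updates major g)) at-major)) (+-comm s 1))

  removedAtMajor⇒g-minor : major ≡ ℓ₀ → g minor ≡ 1
  removedAtMajor⇒g-minor refl = trans (sym (updateAt-minimal minor major g (major≢minor ∘ sym))) at-minor

  removedElsewhere⇒g-major : major ≢ ℓ₀ → g major ≡ s
  removedElsewhere⇒g-major M≢ℓ₀ = trans (sym (updateAt-minimal major ℓ₀ g M≢ℓ₀)) at-major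

-- If the removal at ℓ₀ was in the major class, g has s + 1 there, which survives a removal
-- in the minor class; otherwise g has s in the major class, and a removal there leaves s ∸ 1.
noProfileAfterEveryRemoval : ∀ {n s} → 3 ≤ s → (g : Fin n → ℕ) → ∀ {ℓ₀} → 0 < g ℓ₀ →
                             ¬ (∀ ℓ → 0 < g ℓ → Profile s (decrement g ℓ))
noProfileAfterEveryRemoval {s = s} (s≤s (s≤s (s≤s _))) g {ℓ₀} 0<gℓ₀ allProfiles = byCases (major Fin.≟ ℓ₀)
  where
  open Profile (allProfiles ℓ₀ 0<gℓ₀)
  open Removal g 0<gℓ₀ (allProfiles ℓ₀ 0<gℓ₀)
  valueAfterRemoval : ∀ ℓ → 0 < g ℓ → ∀ ℓ′ →
                      decrement g ℓ ℓ′ ≡ 0 ⊎ decrement g ℓ ℓ′ ≡ 1 ⊎ decrement g ℓ ℓ′ ≡ s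
  valueAfterRemoval ℓ 0<gℓ = profile-values (allProfiles ℓ 0<gℓ)
  byCases : Dec (major ≡ ℓ₀) → Empty.⊥
  byCases (yes M≡ℓ₀) = notProfileValue (s≤s (s≤s z≤n)) 1+n≢n
    (subst (λ x → x ≡ 0 ⊎ x ≡ 1 ⊎ x ≡ s)
      (trans (updateAt-minimal major minor g major≢minor) (removedAtMajor⇒g-major M≡ℓ₀))
      (valueAfterRemoval minor (subst (0 <_) (sym (removedAtMajor⇒g-minor M≡ℓ₀)) (s≤s z≤n)) major))
  byCases (no M≢ℓ₀) = notProfileValue (s≤s (s≤s z≤n)) (1+n≢n ∘ sym)
    (subst (λ x → x ≡ 0 ⊎ x ≡ 1 ⊎ x ≡ s)
      (trans (updateAt-updates major g) (cong (_∸ 1) (removedElsewhere⇒g-major M≢ℓ₀)))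
      (valueAfterRemoval major (subst (0 <_) (sym (removedElsewhere⇒g-major M≢ℓ₀)) (s≤s z≤n)) major))

module _ {n q : ℕ} where
  open ClassBlocks {n} {q}

  realiseClassSizes : ∀ S (e : Fin n → ℕ) → (∀ ℓ → e ℓ ≤ classSize n q S ℓ) →
                      ∃[ K ] K ⊆ S × (∀ ℓ → classSize n q K ℓ ≡ e ℓ)
  realiseClassSizes S e e≤ =
    fromBlocks n q chosen , chosen⊆S , λ ℓ → trans (classSize-fromBlocks chosen ℓ) (proj₂ (proj₂ (pick ℓ)))
    where
    pick : ∀ ℓ → ∃[ r ] r ⊆ block n q S ℓ × ∣ r ∣ ≡ e ℓ
    pick ℓ = subsetOfSize (block n q S ℓ) (e ℓ) (subst (e ℓ ≤_) (classSize≡∣block∣ S ℓ) (e≤ ℓ))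
    chosen : Fin n → Subset q
    chosen ℓ = proj₁ (pick ℓ)
    chosen⊆S : fromBlocks n q chosen ⊆ S
    chosen⊆S = subst (fromBlocks n q chosen ⊆_) (fromBlocks-block S) (fromBlocks-mono (λ ℓ → proj₁ (proj₂ (pick ℓ))))

module _ {n q s : ℕ} (3≤s : 3 ≤ s) where
  open ClassBlocks {n} {q}

  -- For T ⊆ S with s + 2 vertices, removing any vertex of T leaves an edge, so every unit
  -- removal from the class sizes of T is a profile.
  cliqueNumber≤ : CliqueNumberAtMost n (suc s) q (s ∷ 1 ∷ []) (suc s)
  cliqueNumber≤ S clique with ∣ S ∣ ≤? suc s
  ... | yes ∣S∣≤1+s = ∣S∣≤1+s
  ... | no  ∣S∣≰1+s
    with T , T⊆S , ∣T∣≡2+s ← subsetOfSize S (suc (suc s)) (≰⇒> ∣S∣≰1+s)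
    with ℓ₀ , 0<gℓ₀ ← sum-pigeonhole (classSize n q T) 0
                        (subst₂ _<_ (sym (*-zeroʳ n)) (trans (sym ∣T∣≡2+s) (∣K∣≡∑classSize T)) (s≤s z≤n))
    = contradiction removalProfile (noProfileAfterEveryRemoval 3≤s g 0<gℓ₀)
    where
    g : Fin n → ℕ
    g = classSize n q T
    removalProfile : ∀ ℓ → 0 < g ℓ → Profile s (decrement g ℓ)
    removalProfile ℓ 0<gℓ with K , K⊆T , sizes ← realiseClassSizes T (decrement g ℓ) (decrement-≤ g ℓ) =
      Profile-resp sizes (edge⇒profile {n} {q} (≤-trans (s≤s (s≤s z≤n)) 3≤s) {K} (clique K (T⊆S ∘ K⊆T) ∣K∣≡1+s))
      where
      ∣K∣≡1+s : ∣ K ∣ ≡ suc s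
      ∣K∣≡1+s = suc-injective (begin
        suc ∣ K ∣                      ≡⟨ cong suc (trans (∣K∣≡∑classSize K) (sum-cong-≗ sizes)) ⟩
        suc (sum (decrement g ℓ))      ≡⟨ sum-decrement g ℓ 0<gℓ ⟩
        sum g                          ≡⟨ sym (∣K∣≡∑classSize T) ⟩
        ∣ T ∣                          ≡⟨ ∣T∣≡2+s ⟩
        suc (suc s)                    ∎)
        where open ≡-Reasoning

-- Counting edges

Combination : ℕ → ℕ → Set
Combination q k = Refinement (Subset q) (λ A → ∣ A ∣ ≡ k)

-- Equality of subsets is decidable, so it can be recomputed from an irrelevant size proof.
combination-unique-empty : ∀ {q} (A : Subset q) → .(∣ A ∣ ≡ 0) → A ≡ ⊥
combination-unique-empty A ∣A∣≡0 = recompute (≡-dec Bool._≟_ A ⊥) (∣p∣≡0⇒p≡⊥ ∣A∣≡0)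

combinations-zero : ∀ q → Fin (q C 0) ↔ Combination q 0
combinations-zero q = mk↔ₛ′ (λ _ → ⊥ , [ ∣⊥∣≡0 q ]) (λ _ → zero)
  (λ (A , [ ∣A∣≡0 ]) → value-injective (sym (combination-unique-empty A ∣A∣≡0)))
  (λ { zero → refl })

combinations-none : ∀ k → Fin (0 C suc k) ↔ Combination 0 (suc k)
combinations-none k = mk↔ₛ′ (λ ()) (λ { ([] , [ () ]) }) (λ { ([] , [ () ]) }) (λ ())

combination-split : ∀ q k → Combination (suc q) (suc k) ↔ (Combination q k ⊎ Combination q (suc k))
combination-split q k = mk↔ₛ′ to from to∘from from∘to
  where
  to : Combination (suc q) (suc k) → Combination q k ⊎ Combination q (suc k)
  to (inside  ∷ A , [ ∣A∣≡1+k ]) = inj₁ (A , [ suc-injective ∣A∣≡1+k ])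
  to (outside ∷ A , [ ∣A∣≡1+k ]) = inj₂ (A , [ ∣A∣≡1+k ])
  from : Combination q k ⊎ Combination q (suc k) → Combination (suc q) (suc k)
  from (inj₁ (A , [ ∣A∣≡k ]))   = inside  ∷ A , [ cong suc ∣A∣≡k ]
  from (inj₂ (A , [ ∣A∣≡1+k ])) = outside ∷ A , [ ∣A∣≡1+k ]
  to∘from : ∀ x → to (from x) ≡ x
  to∘from (inj₁ _) = refl
  to∘from (inj₂ _) = refl
  from∘to : ∀ x → from (to x) ≡ x
  from∘to (inside  ∷ _ , _) = refl
  from∘to (outside ∷ _ , _) = refl

combinations↔ : ∀ q k → Fin (q C k) ↔ Combination q k
combinations↔ q       zero    = combinations-zero q
combinations↔ zero    (suc k) = combinations-none k
combinations↔ (suc q) (suc k) = subst (λ m → Fin m ↔ Combination (suc q) (suc k)) (nCk+nC[k+1]≡[n+1]C[k+1] q k)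
  (↔-trans FinP.+↔⊎ (↔-trans (combinations↔ q k ⊎-↔ combinations↔ q (suc k)) (↔-sym (combination-split q k))))

module EdgeCount {t q s : ℕ} (2≤s : 2 ≤ s) where
  private
    n : ℕ
    n = suc t
    σ : List ℕ
    σ = s ∷ 1 ∷ []
    1≤s : 1 ≤ s
    1≤s = ≤-trans (s≤s z≤n) 2≤s
    profileOf : ∀ K → IsEdge n (suc s) q σ K → Profile s (classSize n q K)
    profileOf K = edge⇒profile {n} {q} 2≤s {K}
    edgeOf : ∀ K → Profile s (classSize n q K) → IsEdge n (suc s) q σ K
    edgeOf K = profile⇒edge {n} {q} 1≤s {K}
  open ClassBlocks {n} {q}

  EdgeParameters : Set
  EdgeParameters = ((Fin t × Fin n) × Fin q) × Combination q s

  record Decomposition (K : Subset (n * q)) : Set where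
    field
      major minor : Fin n
      at-major    : classSize n q K major ≡ s
      at-minor    : classSize n q K minor ≡ 1
      point       : Fin q
      point∈      : point ∈ block n q K minor

    major≢minor : major ≢ minor
    major≢minor M≡m = >⇒≢ 2≤s (trans (sym at-major) (trans (cong (classSize n q K) M≡m) at-minor))

  classOfSize : ∀ K m → .(∃ λ ℓ → classSize n q K ℓ ≡ m) → ∃ λ ℓ → classSize n q K ℓ ≡ m
  classOfSize K m = recompute (any? (λ ℓ → classSize n q K ℓ ℕ.≟ m))

  -- Edge proofs are irrelevant, so the two classes are found by search; the proof only
  -- guarantees that the search succeeds.
  decompose : ∀ K → .(IsEdge n (suc s) q σ K) → Decomposition K
  decompose K e = record
    { major = proj₁ M ; minor = proj₁ m ; at-major = proj₂ M ; at-minor = proj₂ m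
    ; point = proj₁ y ; point∈ = proj₂ y }
    where
    M : ∃ λ ℓ → classSize n q K ℓ ≡ s
    M = classOfSize K s (Profile.major (profileOf K e) , Profile.at-major (profileOf K e))
    m : ∃ λ ℓ → classSize n q K ℓ ≡ 1
    m = classOfSize K 1 (Profile.minor (profileOf K e) , Profile.at-minor (profileOf K e))
    y : Nonempty (block n q K (proj₁ m))
    y = 0<∣p∣⇒Nonempty (block n q K (proj₁ m))
          (subst (0 <_) (trans (sym (proj₂ m)) (classSize≡∣block∣ K (proj₁ m))) (s≤s z≤n))

  toEdge : EdgeParameters → EdgeSet n (suc s) q σ
  toEdge (((j′ , i) , y) , (A , [ ∣A∣≡s ])) =
    twoClassSet i (punchIn i j′) A y ,
    [ edgeOf (twoClassSet i (punchIn i j′) A y) (twoClassSet-profile (punchInᵢ≢i i j′ ∘ sym) A y ∣A∣≡s) ]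

  fromEdge : EdgeSet n (suc s) q σ → EdgeParameters
  fromEdge (K , [ e ]) =
    ((punchOut major≢minor , major) , point) , (block n q K major , [ trans (sym (classSize≡∣block∣ K major)) at-major ])
    where open Decomposition (decompose K e)

  fromEdge∘toEdge : ∀ x → fromEdge (toEdge x) ≡ x
  fromEdge∘toEdge (((j′ , i) , y) , (A , [ ∣A∣≡s ])) =
    cong₂ _,_ (cong₂ _,_ (cong₂ _,_ j′≡ i≡) y≡) (value-injective A≡)
    where
    j : Fin n
    j = punchIn i j′
    i≢j : i ≢ j
    i≢j = punchInᵢ≢i i j′ ∘ sym
    K : Subset (n * q)
    K = twoClassSet i j A y
    π : Profile s (classSize n q K)
    π = twoClassSet-profile i≢j A y (recompute (∣ A ∣ ℕ.≟ s) ∣A∣≡s)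
    open Decomposition (decompose K (edgeOf K π))
    i≡ : major ≡ i
    i≡ = major-unique π 2≤s at-major
    j≡ : minor ≡ j
    j≡ = minor-unique π 2≤s at-minor
    j′≡ : punchOut major≢minor ≡ j′
    j′≡ = trans (FinP.punchOut-cong′ major j≡) (trans (cong-punchOut i≡) (FinP.punchOut-punchIn i))
      where
      cong-punchOut : ∀ {i′} → i′ ≡ i → ∀ {p : i′ ≢ j} → punchOut p ≡ punchOut i≢j
      cong-punchOut refl = FinP.punchOut-cong i refl
    y≡ : point ≡ y
    y≡ = x∈⁅y⁆⇒x≡y y (subst (point ∈_) minorBlock point∈)
      where
      minorBlock : block n q K minor ≡ ⁅ y ⁆
      minorBlock = trans (cong (block n q K) j≡) (trans (block-fromBlocks (twoBlocks i j A y) j) (twoBlocks-minor i≢j A y))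
    A≡ : block n q K major ≡ A
    A≡ = trans (cong (block n q K) i≡) (trans (block-fromBlocks (twoBlocks i j A y) i) (twoBlocks-major i≢j A y))

  toEdge∘fromEdge : ∀ E → toEdge (fromEdge E) ≡ E
  toEdge∘fromEdge (K , [ e ]) = value-injective (recompute (≡-dec Bool._≟_ _ K)
    (trans (cong (λ j → twoClassSet major j (block n q K major) point) (punchIn-punchOut major≢minor))
           (sym (profile⇒twoClassSet 2≤s (profileOf K e) at-major at-minor point∈))))
    where open Decomposition (decompose K e)

  edges↔ : Fin (t * n * q * (q C s)) ↔ EdgeSet n (suc s) q σ
  edges↔ = ↔-trans FinP.*↔× (↔-trans ((↔-trans FinP.*↔× (FinP.*↔× ×-↔ ↔-refl)) ×-↔ combinations↔ q s)
                    (mk↔ₛ′ toEdge fromEdge toEdge∘fromEdge fromEdge∘toEdge))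

numberOfEdges : ∀ t q {s} → 2 ≤ s → NumberOfEdgesIs (t + 1) (suc s) q (s ∷ 1 ∷ []) (t * (t + 1) * q * (q C s))
numberOfEdges t q {s} 2≤s =
  subst (λ n → NumberOfEdgesIs n (suc s) q (s ∷ 1 ∷ []) (t * n * q * (q C s))) (+-comm 1 t) (EdgeCount.edges↔ {t} {q} 2≤s)

-- Growth of the number of edges

nP′k≤n^k : ∀ n k → n P′ k ≤ n ^ k
nP′k≤n^k n zero    = ≤-refl
nP′k≤n^k n (suc k) = *-mono-≤ (m∸n≤m n k) (nP′k≤n^k n k)

nPk≤n^k : ∀ n k → n P k ≤ n ^ k
nPk≤n^k n k with k ≤ᵇ n
... | true  = nP′k≤n^k n k
... | false = z≤n

nCk*k!≤n^k : ∀ n k → (n C k) * k ! ≤ n ^ k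
nCk*k!≤n^k n k with k ≤? n
... | yes k≤n = begin
  (n C k) * k !                       ≡⟨ cong (_* k !) (nCk≡nPk/k! k≤n) ⟩
  ((n P k) / k !) {{k !≢0}} * k !     ≤⟨ m/n*n≤m (n P k) (k !) {{k !≢0}} ⟩
  n P k                               ≤⟨ nPk≤n^k n k ⟩
  n ^ k                               ∎
  where open ≤-Reasoning
... | no k≰n = subst (λ x → x * k ! ≤ n ^ k) (sym (k>n⇒nCk≡0 (≰⇒> k≰n))) z≤n

[m*n]^k≡m^k*n^k : ∀ m n k → (m * n) ^ k ≡ m ^ k * n ^ k
[m*n]^k≡m^k*n^k m n zero    = refl
[m*n]^k≡m^k*n^k m n (suc k) = trans (cong (m * n *_) ([m*n]^k≡m^k*n^k m n k)) (interchange m n (m ^ k) (n ^ k))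
  where
  interchange : ∀ a b c d → a * b * (c * d) ≡ a * c * (b * d)
  interchange = solve-∀

-- With s = r ∸ 1 every factor is bounded in terms of t: t + 1 ≤ 2t, q ≤ st and (q C s) s! ≤ q ^ s.
edgeCount*[r∸1]!≤ : ∀ r t → 4 ≤ r → 1 ≤ t →
  t * (t + 1) * ((r ∸ 2) * t + 1) * (((r ∸ 2) * t + 1) C (r ∸ 1)) * ((r ∸ 1) !)
    ≤ 2 * r * (t ^ (r + 2)) * ((r ∸ 1) ^ (r ∸ 1))
edgeCount*[r∸1]!≤ r@(suc s) t (s≤s (s≤s (s≤s (s≤s _)))) 1≤t = begin
  t * (t + 1) * q * (q C s) * s !          ≡⟨ *-assoc (t * (t + 1) * q) (q C s) (s !) ⟩
  t * (t + 1) * q * ((q C s) * s !)        ≤⟨ *-mono-≤ (*-mono-≤ (*-monoʳ-≤ t t+1≤2t) q≤st)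
                                                        (≤-trans (nCk*k!≤n^k q s) (^-monoˡ-≤ s q≤st)) ⟩
  t * (2 * t) * (s * t) * (s * t) ^ s      ≡⟨ cong (t * (2 * t) * (s * t) *_) ([m*n]^k≡m^k*n^k s t s) ⟩
  t * (2 * t) * (s * t) * (s ^ s * t ^ s)  ≡⟨ regroup t s (s ^ s) (t ^ s) ⟩
  2 * s * (t ^ s * t ^ 3) * s ^ s          ≤⟨ *-monoˡ-≤ (s ^ s) (*-monoˡ-≤ (t ^ s * t ^ 3) (*-monoʳ-≤ 2 (n≤1+n s))) ⟩
  2 * r * (t ^ s * t ^ 3) * s ^ s          ≡⟨ cong (λ x → 2 * r * x * s ^ s) (^-distribˡ-+-* t s 3) ⟨
  2 * r * t ^ (s + 3) * s ^ s              ≡⟨ cong (λ x → 2 * r * t ^ x * s ^ s) (+-suc s 2) ⟩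
  2 * r * t ^ (r + 2) * s ^ s              ∎
  where
  open ≤-Reasoning
  q : ℕ
  q = (r ∸ 2) * t + 1
  t+1≤2t : t + 1 ≤ 2 * t
  t+1≤2t = subst (t + 1 ≤_) (cong (t +_) (sym (+-identityʳ t))) (+-monoʳ-≤ t 1≤t)
  q≤st : q ≤ s * t
  q≤st = subst (q ≤_) (+-comm ((r ∸ 2) * t) t) (+-monoʳ-≤ ((r ∸ 2) * t) 1≤t)
  regroup : ∀ t s S T → t * (2 * t) * (s * t) * (S * T) ≡ 2 * s * (T * (t * (t * (t * 1)))) * S
  regroup = solve-∀

vertexCount≤ : ∀ m t → 1 ≤ m → (t + 1) * (m * t + 1) ≤ m * (t + 1) ^ 2
vertexCount≤ m t 1≤m = subst ((t + 1) * (m * t + 1) ≤_) (expand m t) (*-monoʳ-≤ (t + 1) (+-monoʳ-≤ (m * t) 1≤m))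
  where
  expand : ∀ m t → (t + 1) * (m * t + m) ≡ m * ((t + 1) * ((t + 1) * 1))
  expand = solve-∀

twoTwoColourable : ∀ n q {s} → 2 ≤ s → TwoTwoColourable n (suc s) q (s ∷ 1 ∷ [])
twoTwoColourable n q 2≤s = n , quotient {n} q , classColouring-22 {n} {q} 2≤s

chromaticNumber : ∀ m t → 1 ≤ m → ChromaticNumberIs (t + 1) (suc (suc m)) (m * t + 1) (suc m ∷ 1 ∷ []) (t + 1)
chromaticNumber m t 1≤m =
  (quotient {n} q , Is22Colouring⇒ProperColouring {n} {suc (suc m)} {q} {σ} (classColouring-22 (s≤s 1≤m))) ,
  atLeastTPlus1Colours
  where
  n q : ℕ
  n = t + 1
  q = m * t + 1
  σ : List ℕ
  σ = suc m ∷ 1 ∷ []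
  atLeastTPlus1Colours : (k : ℕ) (c : Fin (n * q) → Fin k) → ProperColouring n (suc (suc m)) q σ k c → t + 1 ≤ k
  atLeastTPlus1Colours k c proper with k ≤? t
  ... | yes k≤t = properColouring⇒n≤k {n} {q} c proper
                    (≤-<-trans (*-monoˡ-≤ m k≤t) (subst (_< q) (*-comm m t) (m<m+n (m * t) (s≤s z≤n))))
  ... | no  k≰t = subst (_≤ k) (+-comm 1 t) (≰⇒> k≰t)

theorem3p3 : ((r t : ℕ) → 4 ≤ r → 1 ≤ t →
    let n = t + 1
        q = (r ∸ 2) * t + 1
        σ = (r ∸ 1) ∷ 1 ∷ []
    in TwoTwoColourable n r q σ
       × (ChromaticNumberIs n r q σ (t + 1)
          × n * q ≤ (r ∸ 2) * ((t + 1) ^ 2))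
       × CliqueNumberAtMost n r q σ r
       × NumberOfEdgesIs n r q σ (t * (t + 1) * ((r ∸ 2) * t + 1) * (((r ∸ 2) * t + 1) C (r ∸ 1))))
  × (∃[ K ] ((r t : ℕ) → 4 ≤ r → 1 ≤ t →
      t * (t + 1) * ((r ∸ 2) * t + 1) * (((r ∸ 2) * t + 1) C (r ∸ 1)) * ((r ∸ 1) !)
        ≤ K * r * (t ^ (r + 2)) * ((r ∸ 1) ^ (r ∸ 1))))
theorem3p3 = properties , (2 , edgeCount*[r∸1]!≤)
  where
  properties : (r t : ℕ) → 4 ≤ r → 1 ≤ t →
    let n = t + 1
        q = (r ∸ 2) * t + 1
        σ = (r ∸ 1) ∷ 1 ∷ []
    in TwoTwoColourable n r q σ
       × (ChromaticNumberIs n r q σ (t + 1)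
          × n * q ≤ (r ∸ 2) * ((t + 1) ^ 2))
       × CliqueNumberAtMost n r q σ r
       × NumberOfEdgesIs n r q σ (t * (t + 1) * ((r ∸ 2) * t + 1) * (((r ∸ 2) * t + 1) C (r ∸ 1)))
  properties (suc (suc (suc (suc m′)))) t (s≤s 3≤r∸1@(s≤s (s≤s (s≤s _)))) _ =
    twoTwoColourable (t + 1) q (s≤s (s≤s z≤n)) ,
    (chromaticNumber m t (s≤s z≤n) , vertexCount≤ m t (s≤s z≤n)) ,
    cliqueNumber≤ {t + 1} {q} 3≤r∸1 ,
    numberOfEdges t q (s≤s (s≤s z≤n))
    where
    m q : ℕ
    m = suc (suc m′)
    q = m * t + 1
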